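{- Let $G$ be a cop-win graph of corner rank $\alpha\ge2$. Every vertex of corner rank $k>1$ has at least one neighbor of corner rank $k-1$. In particular, if for some $k<\alpha$ there is exactly one vertex $v$ of rank $k$, then $v$ is adjacent to all vertices of rank $k+1$.
   Context: All graphs are finite, nonempty, simple and reflexive. Corner ranking: $N[v]$ is the closed neighborhood. In a graph $H$, $w$ strictly corners a distinct vertex $v$ if $N[v]\subsetneq N[w]$. Set $G^{(1)}=G$, $k=1$. If $G^{(k)}$ is a clique, give its vertices rank $k$ and stop; else if it has no strict corners, give its vertices rank $\infty$ and stop; else give all strict corners of $G^{(k)}$ rank $k$, delete them to get $G^{(k+1)}$, increase $k$, repeat. The corner rank of $G$ is the largest vertex rank; cop-win graphs are those with finite corner rank. -}

module Defs where

open import Data.Nat using (ℕ; zero; suc; _≤_)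
open import Data.Fin using (Fin; _≟_)
open import Data.Bool using (Bool; true; false; _∧_; _∨_; not; if_then_else_)
open import Data.List using (allFin)
open import Data.Bool.ListAction using (all; any)
open import Data.Maybe using (Maybe; just; nothing)
open import Data.Product using (Σ; ∃; _×_)
open import Relation.Nullary using (does)
open import Relation.Binary.PropositionalEquality using (_≡_)

record Graph (n : ℕ) : Set where
  field
    adj      : Fin (suc n) → Fin (suc n) → Bool
    adj-refl : ∀ v → adj v v ≡ true
    adj-sym  : ∀ u v → adj u v ≡ adj v u

-- A set of (remaining) vertices, i.e. an induced subgraph G^(k).
VSet : ℕ → Set
VSet n = Fin (suc n) → Bool

module _ {n : ℕ} (G : Graph n) where
  open Graph G

  allV : (Fin (suc n) → Bool) → Bool
  allV p = all p (allFin (suc n))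

  anyV : (Fin (suc n) → Bool) → Bool
  anyV p = any p (allFin (suc n))

  inN : VSet n → Fin (suc n) → Fin (suc n) → Bool
  inN S v u = S u ∧ adj v u

  nbhdSub : VSet n → Fin (suc n) → Fin (suc n) → Bool
  nbhdSub S v w = allV (λ u → not (inN S v u) ∨ inN S w u)

  strictlyCorners : VSet n → Fin (suc n) → Fin (suc n) → Bool
  strictlyCorners S w v =
    S v ∧ S w ∧ not (does (v ≟ w)) ∧ nbhdSub S v w ∧ not (nbhdSub S w v)

  isStrictCorner : VSet n → Fin (suc n) → Bool
  isStrictCorner S v = anyV (λ w → strictlyCorners S w v)

  isClique : VSet n → Bool
  isClique S = allV (λ u → allV (λ w → not (S u ∧ S w) ∨ adj u w))

  hasStrictCorner : VSet n → Bool
  hasStrictCorner S = anyV (isStrictCorner S)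

  removeCorners : VSet n → VSet n
  removeCorners S v = S v ∧ not (isStrictCorner S v)

  -- Corner ranking procedure, run with fuel; `nothing` encodes rank ∞.
  -- Called on v ∈ S = G^(k).  Each non-terminating round deletes at least
  -- one vertex, so fuel suc n (> number of vertices) suffices.
  rankGo : ℕ → ℕ → VSet n → Fin (suc n) → Maybe ℕ
  rankGo zero      k S v = nothing
  rankGo (suc fuel) k S v =
    if isClique S then just k
    else if not (hasStrictCorner S) then nothing
    else if isStrictCorner S v then just k
    else rankGo fuel (suc k) (removeCorners S) v

  rank : Fin (suc n) → Maybe ℕ
  rank v = rankGo (suc (suc n)) 1 (λ _ → true) v

  CopWinWithCornerRank : ℕ → Set
  CopWinWithCornerRank α =
    (∀ v → ∃ λ r → rank v ≡ just r)
    × (∀ v r → rank v ≡ just r → r ≤ α)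
    × (∃ λ v → rank v ≡ just α)

  Adjacent : Fin (suc n) → Fin (suc n) → Set
  Adjacent u v = adj u v ≡ true

-- Write S for the vertex set G^(k) of one round of the corner ranking and
-- S' for G^(k+1), the set left after deleting the strict corners of S.
-- The heart of the proof is a one-round statement (`corner-neighbour`):
-- if v ∈ S is not a strict corner of S, but S' is a clique or v is a strict
-- corner of S', then some neighbour of v is a strict corner of S.  Indeed,
-- otherwise N_S[v] ⊆ S', and then
--   * a vertex w strictly cornering v in S' already strictly corners v in S;
--   * if S' is a clique, following strict corners upwards from any strict
--     corner u₀ of S ends (the closed degree grows strictly) at a survivor w
--     with N_S[u₀] ⊆ N_S[w]; w dominates v, and strictly so since u₀ ∉ S'.
-- Either way v would be a strict corner of S.  Induction on the rounds turns
-- this into: for r ≥ 1, a vertex of rank r+1 has a neighbour of rank r.  If v is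
-- the only vertex of rank k, every vertex of rank k+1 has a rank-k neighbour,
-- which must be v.

module Submission where

open import Defs
open import Data.Nat using (ℕ; zero; suc; _+_; _≤_; _<_; z≤n; s≤s)
open import Data.Nat.Properties
  using (≤-refl; ≤-trans; ≤-reflexive; <-irrefl; <-≤-trans; n≤1+n; m≤n⇒m≤1+n;
         m<n⇒m<1+n; m≤n⇒m<n∨m≡n; 1+n≰n; m≤n+m; +-identityʳ; +-suc; +-monoˡ-≤)
open import Data.Fin using (Fin; _≟_)
open import Data.Fin.Properties using (any?; ¬∀⟶∃¬)
open import Data.Bool using (Bool; true; false; _∧_; _∨_; not)
open import Data.Bool.Properties
  using (∧-conicalˡ; ∧-conicalʳ; not-¬; ¬-not; not-injective; T-≡)
  renaming (_≟_ to _≟ᵇ_)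
open import Data.List using (List; []; _∷_; allFin; length)
open import Data.List.Properties using (length-tabulate)
open import Data.List.Membership.Propositional using (_∈_; lose)
open import Data.List.Membership.Propositional.Properties using (∈-allFin)
open import Data.List.Relation.Unary.Any using (here; there; satisfied)
import Data.List.Relation.Unary.All as All
open import Data.List.Relation.Unary.All.Properties using (all⁺; all⁻)
open import Data.List.Relation.Unary.Any.Properties using (any⁺; any⁻)
open import Data.Maybe using (just)
open import Data.Maybe.Properties using (just-injective)
open import Data.Product using (∃; _×_; _,_; proj₁; proj₂)
open import Data.Sum using (_⊎_; inj₁; inj₂; [_,_]′)
open import Function using (_∘_; id)
open import Function.Bundles using (Equivalence)
open import Relation.Nullary using (¬_; yes; no; does; contradiction; _×-dec_)
open import Relation.Binary.PropositionalEquality using (_≡_; refl; trans; subst; cong; cong₂)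

open Equivalence using (to; from)

∧-split : ∀ {a b} → a ∧ b ≡ true → a ≡ true × b ≡ true
∧-split {a} {b} h = ∧-conicalˡ a b h , ∧-conicalʳ a b h

⇒ᵇ-elim : ∀ {a b} → not a ∨ b ≡ true → a ≡ true → b ≡ true
⇒ᵇ-elim h refl = h

⇒ᵇ-intro : ∀ a {b} → (a ≡ true → b ≡ true) → not a ∨ b ≡ true
⇒ᵇ-intro true  f = f refl
⇒ᵇ-intro false f = refl

⇒ᵇ-false : ∀ a {b} → not a ∨ b ≡ false → a ≡ true × b ≡ false
⇒ᵇ-false true h = refl , h

module _ {A : Set} where

  count : (A → Bool) → List A → ℕ
  count p []       = 0
  count p (y ∷ ys) with p y
  ... | true  = suc (count p ys)
  ... | false = count p ys

  count-≤-length : ∀ p xs → count p xs ≤ length xs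
  count-≤-length p []       = z≤n
  count-≤-length p (y ∷ ys) with p y
  ... | true  = s≤s (count-≤-length p ys)
  ... | false = m≤n⇒m≤1+n (count-≤-length p ys)

  module _ (p q : A → Bool) (p⇒q : ∀ y → p y ≡ true → q y ≡ true) where

    count-mono : ∀ xs → count p xs ≤ count q xs
    count-mono []       = z≤n
    count-mono (y ∷ ys) with p y in py | q y in qy
    ... | true  | true  = s≤s (count-mono ys)
    ... | true  | false = contradiction (p⇒q y py) (not-¬ qy)
    ... | false | true  = m≤n⇒m≤1+n (count-mono ys)
    ... | false | false = count-mono ys

    count-mono-< : ∀ xs {x} → x ∈ xs → p x ≡ false → q x ≡ true →
                   count p xs < count q xs
    count-mono-< (y ∷ ys) (here refl) px qx rewrite px | qx = s≤s (count-mono ys)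
    count-mono-< (y ∷ ys) (there x∈ys) px qx with p y in py | q y in qy
    ... | true  | true  = s≤s (count-mono-< ys x∈ys px qx)
    ... | true  | false = contradiction (p⇒q y py) (not-¬ qy)
    ... | false | true  = m<n⇒m<1+n (count-mono-< ys x∈ys px qx)
    ... | false | false = count-mono-< ys x∈ys px qx

module CornerRanking {n : ℕ} (G : Graph n) where
  open Graph G

  V : Set
  V = Fin (suc n)

  module _ (p : V → Bool) where

    allV-elim : allV G p ≡ true → ∀ v → p v ≡ true
    allV-elim h v = to T-≡ (All.lookup (all⁺ p _ (from T-≡ h)) (∈-allFin v))

    allV-intro : (∀ v → p v ≡ true) → allV G p ≡ true
    allV-intro h = to T-≡ (all⁻ p {allFin (suc n)} (All.tabulate (λ {v} _ → from T-≡ (h v))))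

    allV-false : allV G p ≡ false → ∃ λ v → p v ≡ false
    allV-false h with ¬∀⟶∃¬ (suc n) _ (λ v → p v ≟ᵇ true) (λ all → not-¬ (allV-intro all) h)
    ... | v , ¬pv = v , ¬-not ¬pv

    anyV-elim : anyV G p ≡ true → ∃ λ v → p v ≡ true
    anyV-elim h with satisfied (any⁻ p (allFin (suc n)) (from T-≡ h))
    ... | v , pv = v , to T-≡ pv

    anyV-intro : ∀ v → p v ≡ true → anyV G p ≡ true
    anyV-intro v pv = to T-≡ (any⁺ {xs = allFin (suc n)} p (lose (∈-allFin v) (from T-≡ pv)))

  Dominated : VSet n → V → V → Set
  Dominated S v w = ∀ u → inN G S v u ≡ true → inN G S w u ≡ true

  -- w strictly corners v in S: both lie in S and N_S[v] ⊊ N_S[w]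
  -- (strictness already forces v ≢ w).
  Corners : VSet n → V → V → Set
  Corners S w v = S v ≡ true × S w ≡ true × Dominated S v w × ¬ Dominated S w v

  inN-intro : ∀ S {x u} → S u ≡ true → adj x u ≡ true → inN G S x u ≡ true
  inN-intro S su xu = cong₂ _∧_ su xu

  inN-elim : ∀ S {x u} → inN G S x u ≡ true → S u ≡ true × adj x u ≡ true
  inN-elim S {x} {u} = ∧-split {S u} {adj x u}

  inN-transfer : ∀ S T {x u} → T u ≡ true → inN G S x u ≡ true → inN G T x u ≡ true
  inN-transfer S T tu h = inN-intro T tu (proj₂ (inN-elim S h))

  nbhdSub-sound : ∀ S v w → nbhdSub G S v w ≡ true → Dominated S v w
  nbhdSub-sound S v w h u = ⇒ᵇ-elim (allV-elim _ h u)

  nbhdSub-complete : ∀ S v w → Dominated S v w → nbhdSub G S v w ≡ true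
  nbhdSub-complete S v w d = allV-intro _ (λ u → ⇒ᵇ-intro (inN G S v u) (d u))

  non-domination-witness : ∀ S v w → ¬ Dominated S w v →
    ∃ λ u → inN G S w u ≡ true × inN G S v u ≡ false
  non-domination-witness S v w ¬dom
    with allV-false _ (¬-not (¬dom ∘ nbhdSub-sound S w v))
  ... | u , h = u , ⇒ᵇ-false (inN G S w u) h

  strictlyCorners-sound : ∀ S w v → strictlyCorners G S w v ≡ true → Corners S w v
  strictlyCorners-sound S w v h =
    let (sv , h₁) = ∧-split h
        (sw , h₂) = ∧-split h₁
        (_  , h₃) = ∧-split {not (does (v ≟ w))} h₂
        (dom , ¬back) = ∧-split h₃
    in sv , sw , nbhdSub-sound S v w dom ,
       λ back → not-¬ (nbhdSub-complete S w v back) (not-injective {y = false} ¬back)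

  strictlyCorners-complete : ∀ S w v → Corners S w v → strictlyCorners G S w v ≡ true
  strictlyCorners-complete S w v (sv , sw , dom , ¬back) with v ≟ w
  ... | yes refl = contradiction (λ _ → id) ¬back
  ... | no _ rewrite sv | sw | nbhdSub-complete S v w dom
                   | ¬-not (¬back ∘ nbhdSub-sound S w v) = refl

  isStrictCorner-sound : ∀ S v → isStrictCorner G S v ≡ true → ∃ λ w → Corners S w v
  isStrictCorner-sound S v h with anyV-elim _ h
  ... | w , c = w , strictlyCorners-sound S w v c

  isStrictCorner-complete : ∀ S w v → Corners S w v → isStrictCorner G S v ≡ true
  isStrictCorner-complete S w v c = anyV-intro _ w (strictlyCorners-complete S w v c)

  isClique-sound : ∀ S → isClique G S ≡ true →
    ∀ u w → S u ≡ true → S w ≡ true → adj u w ≡ true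
  isClique-sound S h u w su sw =
    ⇒ᵇ-elim (allV-elim _ (allV-elim _ h u) w) (cong₂ _∧_ su sw)

  removeCorners-sound : ∀ S v → removeCorners G S v ≡ true →
    S v ≡ true × isStrictCorner G S v ≡ false
  removeCorners-sound S v h =
    let (sv , nc) = ∧-split h in sv , not-injective {y = false} nc

  removeCorners-complete : ∀ S v → S v ≡ true → isStrictCorner G S v ≡ false →
    removeCorners G S v ≡ true
  removeCorners-complete S v sv nc = cong₂ _∧_ sv (cong not nc)

  degree : VSet n → V → ℕ
  degree S x = count (inN G S x) (allFin (suc n))

  degree-≤ : ∀ S x → degree S x ≤ suc n
  degree-≤ S x = subst (degree S x ≤_) (length-tabulate id) (count-≤-length (inN G S x) (allFin (suc n)))

  corner-degree-< : ∀ S w x → Corners S w x → degree S x < degree S w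
  corner-degree-< S w x (_ , _ , dom , ¬back) with non-domination-witness S x w ¬back
  ... | u , wu , xu = count-mono-< (inN G S x) (inN G S w) dom _ (∈-allFin u) xu wu

  -- Every vertex x of S is dominated by a vertex surviving the round:
  -- follow strict corners upwards.  Since degrees rise strictly and stay
  -- ≤ n+1, the slack d with n+1 ≤ degree x + d bounds the number of steps.
  dominated-by-survivor : ∀ S d x → S x ≡ true → suc n ≤ degree S x + d →
    ∃ λ w → removeCorners G S w ≡ true × Dominated S x w
  dominated-by-survivor S d x sx slack with isStrictCorner G S x in cx
  ... | false = x , removeCorners-complete S x sx cx , λ _ → id
  dominated-by-survivor S zero x sx slack | true with isStrictCorner-sound S x cx
  ... | w , c = contradiction
        (<-≤-trans (corner-degree-< S w x c)
          (≤-trans (degree-≤ S w) (subst (suc n ≤_) (+-identityʳ _) slack)))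
        (<-irrefl refl)
  dominated-by-survivor S (suc d) x sx slack | true with isStrictCorner-sound S x cx
  ... | w , c@(_ , sw , dom , _)
    with dominated-by-survivor S d w sw
           (≤-trans slack (≤-trans (≤-reflexive (+-suc (degree S x) d))
                                   (+-monoˡ-≤ d (corner-degree-< S w x c))))
  ... | w* , survives , dom* = w* , survives , λ u → dom* u ∘ dom u

  -- The one-round lemma.  Write S' for removeCorners S and assume that
  -- N_S[v] ⊆ S', i.e. no neighbour of v is a strict corner of S.

  Survives : VSet n → V → Set
  Survives S v = ∀ u → inN G S v u ≡ true → removeCorners G S u ≡ true

  corners-lift : ∀ S w v → S v ≡ true → Survives S v →
    Corners (removeCorners G S) w v → Corners S w v
  corners-lift S w v sv survive (_ , s'w , dom' , ¬back') =
    sv , proj₁ (removeCorners-sound S w s'w) , dom , ¬back' ∘ restrict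
    where
    S' : VSet n
    S' = removeCorners G S
    S'⊆S : ∀ u → S' u ≡ true → S u ≡ true
    S'⊆S u = proj₁ ∘ removeCorners-sound S u
    dom : Dominated S v w
    dom u vu = let w'u = dom' u (inN-transfer S S' (survive u vu) vu) in
      inN-transfer S' S (S'⊆S u (proj₁ (inN-elim S' w'u))) w'u
    restrict : Dominated S w v → Dominated S' w v
    restrict back u wu = let s'u = proj₁ (inN-elim S' wu) in
      inN-transfer S S' s'u (back u (inN-transfer S' S (S'⊆S u s'u) wu))

  -- If S' is a clique, v is strictly cornered in S by a survivor w that
  -- dominates some strict corner u₀ of S; strictness because u₀ ∉ S'.
  clique-corners : ∀ S v → S v ≡ true → Survives S v → hasStrictCorner G S ≡ true →
    isClique G (removeCorners G S) ≡ true → ∃ λ w → Corners S w v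
  clique-corners S v sv survive hs clique with anyV-elim _ hs
  ... | u₀ , cu₀ with isStrictCorner-sound S u₀ cu₀
  ... | _ , (su₀ , _) with dominated-by-survivor S (suc n) u₀ su₀ (m≤n+m (suc n) (degree S u₀))
  ... | w , s'w , dom₀ = w , sv , proj₁ (removeCorners-sound S w s'w) , dom , ¬back
    where
    dom : Dominated S v w
    dom u vu = let s'u = survive u vu in
      inN-intro S (proj₁ (removeCorners-sound S u s'u))
                (isClique-sound _ clique w u s'w s'u)
    ¬back : ¬ Dominated S w v
    ¬back back = not-¬ cu₀ (proj₂ (removeCorners-sound S u₀
      (survive u₀ (back u₀ (dom₀ u₀ (inN-intro S su₀ (adj-refl u₀)))))))

  corner-neighbour : ∀ S v → S v ≡ true → isStrictCorner G S v ≡ false →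
    hasStrictCorner G S ≡ true →
    isClique G (removeCorners G S) ≡ true ⊎ isStrictCorner G (removeCorners G S) v ≡ true →
    ∃ λ u → adj v u ≡ true × S u ≡ true × isStrictCorner G S u ≡ true
  corner-neighbour S v sv cv hs next
    with any? (λ u → (adj v u ≟ᵇ true) ×-dec (S u ≟ᵇ true) ×-dec (isStrictCorner G S u ≟ᵇ true))
  ... | yes found = found
  ... | no none = contradiction (isStrictCorner-complete S _ v (proj₂ cornered)) (not-¬ cv)
    where
    survive : Survives S v
    survive u vu = let (su , a) = inN-elim S vu in
      removeCorners-complete S u su (¬-not (λ cu → none (u , a , su , cu)))
    lift : ∃ (λ w → Corners (removeCorners G S) w v) → ∃ λ w → Corners S w v
    lift (w , c) = w , corners-lift S w v sv survive c
    cornered : ∃ λ w → Corners S w v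
    cornered = [ clique-corners S v sv survive hs , lift ∘ isStrictCorner-sound _ v ]′ next

  data Round (f k : ℕ) (S : VSet n) (v : V) (r : ℕ) : Set where
    clique   : isClique G S ≡ true → k ≡ r → Round f k S v r
    corner   : isClique G S ≡ false → hasStrictCorner G S ≡ true →
               isStrictCorner G S v ≡ true → k ≡ r → Round f k S v r
    survivor : isClique G S ≡ false → hasStrictCorner G S ≡ true →
               isStrictCorner G S v ≡ false →
               rankGo G f (suc k) (removeCorners G S) v ≡ just r → Round f k S v r

  round : ∀ f k S v {r} → rankGo G (suc f) k S v ≡ just r → Round f k S v r
  round f k S v h with isClique G S in cl | hasStrictCorner G S in hs | isStrictCorner G S v in cv
  ... | true  | _     | _     = clique cl (just-injective h)
  ... | false | true  | true  = corner cl hs cv (just-injective h)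
  ... | false | true  | false = survivor cl hs cv h

  corner-ranked : ∀ f k S u → isClique G S ≡ false → hasStrictCorner G S ≡ true →
    isStrictCorner G S u ≡ true → rankGo G (suc f) k S u ≡ just k
  corner-ranked f k S u cl hs cu rewrite cl | hs | cu = refl

  survivor-ranked : ∀ f k S u → isClique G S ≡ false → hasStrictCorner G S ≡ true →
    isStrictCorner G S u ≡ false →
    rankGo G (suc f) k S u ≡ rankGo G f (suc k) (removeCorners G S) u
  survivor-ranked f k S u cl hs cu rewrite cl | hs | cu = refl

  rankGo-≥ : ∀ f k S v {r} → rankGo G f k S v ≡ just r → k ≤ r
  rankGo-≥ zero    k S v ()
  rankGo-≥ (suc f) k S v h with round f k S v h
  ... | clique _ refl     = ≤-refl
  ... | corner _ _ _ refl = ≤-refl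
  ... | survivor _ _ _ h' = ≤-trans (n≤1+n k) (rankGo-≥ f (suc k) _ v h')

  ranked-at-start : ∀ f k S v → rankGo G f k S v ≡ just k →
    isClique G S ≡ true ⊎ isStrictCorner G S v ≡ true
  ranked-at-start zero    k S v ()
  ranked-at-start (suc f) k S v h with round f k S v h
  ... | clique cl _        = inj₁ cl
  ... | corner _ _ cv _    = inj₂ cv
  ... | survivor _ _ _ h' = contradiction (rankGo-≥ f (suc k) _ v h') (<-irrefl refl)

  -- A vertex of S ranked r+1 (with r ≥ k) when starting from round k has a
  -- neighbour in S ranked r: induction on rounds; at round r itself this
  -- is `corner-neighbour`.
  previous-rank-neighbour : ∀ f k S v r → S v ≡ true → k ≤ r →
    rankGo G f k S v ≡ just (suc r) →
    ∃ λ u → adj v u ≡ true × S u ≡ true × rankGo G f k S u ≡ just r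
  previous-rank-neighbour zero    k S v r sv k≤r ()
  previous-rank-neighbour (suc f) k S v r sv k≤r h with round f k S v h
  ... | clique _ refl     = contradiction k≤r 1+n≰n
  ... | corner _ _ _ refl = contradiction k≤r 1+n≰n
  ... | survivor cl hs cv h' with m≤n⇒m<n∨m≡n k≤r
  ...   | inj₁ k<r with previous-rank-neighbour f (suc k) _ v r
                          (removeCorners-complete S v sv cv) k<r h'
  ...     | u , vu , s'u , hu =
              let (su , cu) = removeCorners-sound S u s'u
              in u , vu , su , trans (survivor-ranked f k S u cl hs cu) hu
  previous-rank-neighbour (suc f) k S v k sv _ h | survivor cl hs cv h' | inj₂ refl
    with corner-neighbour S v sv cv hs (ranked-at-start f (suc k) _ v h')
  ... | u , vu , su , cu = u , vu , su , corner-ranked f k S u cl hs cu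

  rank-positive : ∀ v {r} → rank G v ≡ just r → 1 ≤ r
  rank-positive v = rankGo-≥ (suc (suc n)) 1 (λ _ → true) v

  lower-rank-neighbour : ∀ v r → 1 ≤ r → rank G v ≡ just (suc r) →
    ∃ λ u → Adjacent G v u × rank G u ≡ just r
  lower-rank-neighbour v r 1≤r h
    with previous-rank-neighbour (suc (suc n)) 1 (λ _ → true) v r refl 1≤r h
  ... | u , vu , _ , hu = u , vu , hu

open CornerRanking using (rank-positive; lower-rank-neighbour)
open Graph using (adj-sym)

corollary3p17 : ∀ {n} (G : Graph n) (α : ℕ) → CopWinWithCornerRank G α → 2 ≤ α →
    (∀ (v : Fin (suc n)) (k : ℕ) → 1 ≤ k → rank G v ≡ just (suc k) →
    ∃ λ u → Adjacent G v u × rank G u ≡ just k)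
    × (∀ (k : ℕ) → k < α → (v : Fin (suc n)) → rank G v ≡ just k →
    (∀ u → rank G u ≡ just k → u ≡ v) →
    ∀ w → rank G w ≡ just (suc k) → Adjacent G v w)
corollary3p17 G α _ _ = lower-rank-neighbour G , unique-rank-adjacent
  where
  -- Every w of rank k+1 has a neighbour of rank k, which can only be v.
  unique-rank-adjacent : ∀ k → k < α → ∀ v → rank G v ≡ just k →
    (∀ u → rank G u ≡ just k → u ≡ v) →
    ∀ w → rank G w ≡ just (suc k) → Adjacent G v w
  unique-rank-adjacent k _ v hv unique w hw
    with lower-rank-neighbour G w k (rank-positive G v hv) hw
  ... | u , wu , hu with unique u hu
  ... | refl = trans (adj-sym G u w) wu
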